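{- There is a computable reduction from Problem A to Problem B, where: Problem A: given a polynomial $P$ in $n$ variables with rational coefficients, decide whether there exist rationals $q_0,\dots,q_n$ with $q_0\cdot P(\frac{q_1}{q_0},\dots,\frac{q_n}{q_0})=0$, $q_0\le q_i$ for $i=1,\dots,n$, and $q_i\ge1$ for $i=0,\dots,n$. Problem B: given variables $q_0,q_1,\dots,q_n$ and a finite set of equations of which at most one is of the form $\sum_{i\in I}\alpha_iq_i=0$ (for some $I\subseteq\{0,\dots,n\}$ and $\alpha_i\in\mathbb{Q}$) and all others are of the form $q_iq_j=q_kq_\ell$ (for some $i,j,k,\ell\in\{0,\dots,n\}$), decide whether there is a rational solution satisfying $1\le q_0\le q_i$ for every $i=1,\dots,n$.
   Context: A computable reduction from one problem to another is an algorithm transforming each instance of the first problem into an instance of the second such that the first instance has a solution if and only if the second does. -}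

module Defs where

open import Data.Nat using (ℕ; zero; suc)
open import Data.Fin using (Fin; zero; suc)
open import Data.Vec using (Vec; lookup; tabulate)
open import Data.List using (List; foldr; map)
open import Data.List.Relation.Unary.All using (All)
open import Data.Maybe using (Maybe; just; nothing)
open import Data.Product using (Σ; ∃; _×_; _,_)
open import Data.Unit using (⊤)
open import Relation.Binary.PropositionalEquality using (_≡_)
open import Relation.Nullary using (yes; no)
open import Data.Rational using (ℚ; 0ℚ; 1ℚ; _+_; _*_; _≤_; 1/_; _≟_)
open import Data.Rational.Properties using ()
import Data.Rational.Base as QB
open import Function.Bundles using (_⇔_)

_^ℚ_ : ℚ → ℕ → ℚ
x ^ℚ zero  = 1ℚ
x ^ℚ suc k = x * (x ^ℚ k)

-- division with the (irrelevant here) convention x / 0 = 0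
_÷'_ : ℚ → ℚ → ℚ
p ÷' q with q ≟ 0ℚ
... | yes _ = 0ℚ
... | no q≢0 = p * (1/_ q {{QB.≢-nonZero q≢0}})

-- a polynomial in n variables with rational coefficients:
-- a finite list of monomials (coefficient c, exponent vector e) = c · ∏ xᵢ^eᵢ
Poly : ℕ → Set
Poly n = List (ℚ × Vec ℕ n)

prodFin : (n : ℕ) → (Fin n → ℚ) → ℚ
prodFin zero    f = 1ℚ
prodFin (suc n) f = f zero * prodFin n (λ i → f (suc i))

sumFin : (n : ℕ) → (Fin n → ℚ) → ℚ
sumFin zero    f = 0ℚ
sumFin (suc n) f = f zero + sumFin n (λ i → f (suc i))

evalMono : {n : ℕ} → (Fin n → ℚ) → ℚ × Vec ℕ n → ℚ
evalMono {n} x (c , e) = c * prodFin n (λ i → x i ^ℚ lookup e i)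

eval : {n : ℕ} → Poly n → (Fin n → ℚ) → ℚ
eval P x = foldr (λ m acc → evalMono x m + acc) 0ℚ P

InstA : Set
InstA = Σ ℕ Poly

-- q : Fin (suc n) → ℚ, q zero = q₀, q (suc i) = q_{i+1}
SolA : InstA → Set
SolA (n , P) = ∃ λ (q : Fin (suc n) → ℚ) →
    (q zero * eval P (λ i → q (suc i) ÷' q zero) ≡ 0ℚ)
  × ((i : Fin n) → q zero ≤ q (suc i))
  × ((i : Fin (suc n)) → 1ℚ ≤ q i)

-- a linear equation Σ_{i ∈ I} αᵢ qᵢ = 0, given by its coefficient vector
-- (αᵢ = 0 for i ∉ I)
LinEq : ℕ → Set
LinEq n = Vec ℚ (suc n)

QuadEq : ℕ → Set
QuadEq n = Fin (suc n) × Fin (suc n) × Fin (suc n) × Fin (suc n)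

record InstB : Set where
  constructor mkB
  field
    nvars : ℕ
    lin   : Maybe (LinEq nvars)
    quads : List (QuadEq nvars)

satLin : {n : ℕ} → (Fin (suc n) → ℚ) → Maybe (LinEq n) → Set
satLin q nothing  = ⊤
satLin {n} q (just α) = sumFin (suc n) (λ i → lookup α i * q i) ≡ 0ℚ

satQuad : {n : ℕ} → (Fin (suc n) → ℚ) → QuadEq n → Set
satQuad q (i , j , k , l) = q i * q j ≡ q k * q l

SolB : InstB → Set
SolB (mkB n lin quads) = ∃ λ (q : Fin (suc n) → ℚ) →
    satLin q lin
  × All (satQuad q) quads
  × 1ℚ ≤ q zero
  × ((i : Fin n) → q zero ≤ q (suc i))

-- a (computable) reduction: Agda functions are computable by construction
Reduction : (A : Set) → (B : Set) → (A → Set) → (B → Set) → Set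
Reduction A B SA SB = Σ (A → B) λ f → (x : A) → SA x ⇔ SB (f x)

-- Write yᵢ = qᵢ/q₀.  Each term c·y₁^e₁⋯yₙ^eₙ of P is computed by a chain of new
-- variables t with t·q₀ = s·qᵢ starting from s = q₀; inductively every variable
-- equals q₀ times a monomial in y, so the single linear equation Σ c·t = 0 says
-- q₀·P(y) = 0.  Conversely, as q₀ ≥ 1 is invertible, the quadratic equations force
-- every variable of a solution to take exactly these values.  Since all yᵢ ≥ 1,
-- every such monomial is ≥ 1, so the new variables also satisfy q₀ ≤ t.
module Submission where

open import Defs
open import Data.Nat using (ℕ; zero; suc)
open import Data.Fin using (Fin; zero; suc; punchIn)
open import Data.Vec using (Vec; []; _∷_; lookup; tabulate)
open import Data.Vec.Properties using (lookup∘tabulate)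
open import Data.Vec.Functional using (insertAt) renaming (_∷_ to _∷ᶠ_)
open import Data.Vec.Functional.Properties using (insertAt-punchIn)
open import Data.List using (List; []; _∷_; map)
open import Data.List.Relation.Unary.All using (All; []; _∷_)
import Data.List.Relation.Unary.All as All
open import Data.List.Relation.Unary.All.Properties using (map⁺; map⁻)
open import Data.Maybe using (just)
open import Data.Product using (∃; _×_; _,_; proj₂)
open import Function using (_∘_; id)
open import Function.Bundles using (_⇔_; mk⇔)
open import Relation.Binary.PropositionalEquality
open import Relation.Nullary using (yes; no; contradiction)
open import Data.Rational using (ℚ; 0ℚ; 1ℚ; _+_; _*_; _≤_; _≟_; 1/_; Positive; NonZero; positive; ≢-nonZero)
open import Data.Rational.Properties
open import Algebra.Bundles using (CommutativeMonoid)
import Algebra.Properties.CommutativeSemigroup as CommutativeSemigroupProperties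
open import Data.Rational.Solver using (module +-*-Solver)

private
  variable
    n N : ℕ

  module +-CS = CommutativeSemigroupProperties (CommutativeMonoid.commutativeSemigroup +-0-commutativeMonoid)
  module *-CS = CommutativeSemigroupProperties (CommutativeMonoid.commutativeSemigroup *-1-commutativeMonoid)

1≤⇒pos : ∀ {p} → 1ℚ ≤ p → Positive p
1≤⇒pos 1≤p = positive (<-≤-trans (positive⁻¹ 1ℚ) 1≤p)

p≤p*q : ∀ p .{{_ : Positive p}} {q} → 1ℚ ≤ q → p ≤ p * q
p≤p*q p 1≤q = ≤-trans (≤-reflexive (sym (*-identityʳ p))) (*-monoˡ-≤-nonNeg p {{pos⇒nonNeg p}} 1≤q)

1≤p*q : ∀ {p q} → 1ℚ ≤ p → 1ℚ ≤ q → 1ℚ ≤ p * q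
1≤p*q {p} 1≤p 1≤q = ≤-trans 1≤p (p≤p*q p {{1≤⇒pos 1≤p}} 1≤q)

*-cancelʳ-≡-pos : ∀ {p q} r .{{_ : Positive r}} → p * r ≡ q * r → p ≡ q
*-cancelʳ-≡-pos r pr≡qr = ≤-antisym (*-cancelʳ-≤-pos r (≤-reflexive pr≡qr))
                                    (*-cancelʳ-≤-pos r (≤-reflexive (sym pr≡qr)))

q*[p÷'q]≡p : ∀ p q .{{_ : Positive q}} → q * (p ÷' q) ≡ p
q*[p÷'q]≡p p q with q ≟ 0ℚ
... | yes refl = contradiction (positive⁻¹ 0ℚ) (<-irrefl refl)
... | no q≢0 = begin
  q * (p * r) ≡⟨ cong (q *_) (*-comm p r) ⟩
  q * (r * p) ≡⟨ sym (*-assoc q r p) ⟩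
  q * r * p   ≡⟨ cong (_* p) (*-inverseʳ q) ⟩
  1ℚ * p      ≡⟨ *-identityˡ p ⟩
  p           ∎
  where
  open ≡-Reasoning
  instance
    q-nonZero : NonZero q
    q-nonZero = ≢-nonZero q≢0
  r = 1/ q

[x*a]*[x*b]≡x*[a*b]*x : ∀ x a b → (x * a) * (x * b) ≡ x * (a * b) * x
[x*a]*[x*b]≡x*[a*b]*x = solve 3 (λ x a b → (x :* a) :* (x :* b) := x :* (a :* b) :* x) refl
  where open +-*-Solver

1≤p÷'q : ∀ {p} q .{{_ : Positive q}} → q ≤ p → 1ℚ ≤ p ÷' q
1≤p÷'q {p} q q≤p = *-cancelˡ-≤-pos q (begin
  q * 1ℚ       ≡⟨ *-identityʳ q ⟩
  q            ≤⟨ q≤p ⟩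
  p            ≡⟨ sym (q*[p÷'q]≡p p q) ⟩
  q * (p ÷' q) ∎)
  where open ≤-Reasoning

sumFin-cong : ∀ {k} {f g : Fin k → ℚ} → f ≗ g → sumFin k f ≡ sumFin k g
sumFin-cong {zero}  f≗g = refl
sumFin-cong {suc k} f≗g = cong₂ _+_ (f≗g zero) (sumFin-cong (f≗g ∘ suc))

dot : ∀ {k} → (Fin k → ℚ) → (Fin k → ℚ) → ℚ
dot {k} α v = sumFin k (λ j → α j * v j)

dot-zeroˡ : ∀ {k} (v : Fin k → ℚ) → dot (λ _ → 0ℚ) v ≡ 0ℚ
dot-zeroˡ {zero}  v = refl
dot-zeroˡ {suc k} v = cong₂ _+_ (*-zeroˡ (v zero)) (dot-zeroˡ (v ∘ suc))

dot-scaleʳ : ∀ {k} (α : Fin k → ℚ) x v → dot α (λ j → x * v j) ≡ x * dot α v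
dot-scaleʳ {zero}  α x v = sym (*-zeroʳ x)
dot-scaleʳ {suc k} α x v = begin
  α zero * (x * v zero) + dot (α ∘ suc) (λ j → x * v (suc j))
    ≡⟨ cong₂ _+_ (*-CS.x∙yz≈y∙xz (α zero) x (v zero)) (dot-scaleʳ (α ∘ suc) x (v ∘ suc)) ⟩
  x * (α zero * v zero) + x * dot (α ∘ suc) (v ∘ suc)
    ≡⟨ sym (*-distribˡ-+ x _ _) ⟩
  x * dot α v ∎
  where open ≡-Reasoning

dot-insertAt₁ : (α v : Fin (suc N) → ℚ) (a b : ℚ) →
                dot (insertAt α (suc zero) a) (insertAt v (suc zero) b) ≡ a * b + dot α v
dot-insertAt₁ α v a b = +-CS.x∙yz≈y∙xz (α zero * v zero) (a * b) (dot (α ∘ suc) (v ∘ suc))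

-- Variable 0 is q₀.  A gate `gate c a b` adds a variable t with the equation
-- t · q₀ = a · b and the term c · t to the linear equation; its variable is
-- inserted at position 1, shifting the older ones by `punchIn 1`.
record Gate (N : ℕ) : Set where
  constructor gate
  field
    coefficient : ℚ
    left right  : Fin (suc N)

data Circuit (n : ℕ) : ℕ → Set where
  inputs : Circuit n n
  _▷_    : Circuit n N → Gate N → Circuit n (suc N)

shift : Fin (suc N) → Fin (suc (suc N))
shift = punchIn (suc zero)

shiftQuad : QuadEq N → QuadEq (suc N)
shiftQuad (i , j , k , l) = shift i , shift j , shift k , shift l

input : Circuit n N → Fin n → Fin (suc N)
input inputs  = suc
input (C ▷ g) = shift ∘ input C

coefficients : Circuit n N → Fin (suc N) → ℚ
coefficients inputs             = λ _ → 0ℚ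
coefficients (C ▷ gate c _ _) = insertAt (coefficients C) (suc zero) c

equations : Circuit n N → List (QuadEq N)
equations inputs             = []
equations (C ▷ gate _ a b) = (suc zero , zero , shift a , shift b) ∷ map shiftQuad (equations C)

-- In the intended solution variable j has the value q₀ · monomial C y j.
monomial : Circuit n N → (Fin n → ℚ) → Fin (suc N) → ℚ
monomial inputs           y = 1ℚ ∷ᶠ y
monomial (C ▷ gate _ a b) y = insertAt (monomial C y) (suc zero) (monomial C y a * monomial C y b)

output : Circuit n N → (Fin n → ℚ) → ℚ
output C y = dot (coefficients C) (monomial C y)

monomial-zero : ∀ (C : Circuit n N) y → monomial C y zero ≡ 1ℚ
monomial-zero inputs  y = refl
monomial-zero (C ▷ _) y = monomial-zero C y

monomial-input : ∀ (C : Circuit n N) y i → monomial C y (input C i) ≡ y i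
monomial-input inputs           y i = refl
monomial-input (C ▷ gate _ a b) y i =
  trans (insertAt-punchIn (monomial C y) (suc zero) _ (input C i)) (monomial-input C y i)

monomial-≥1 : ∀ (C : Circuit n N) {y} → (∀ i → 1ℚ ≤ y i) → ∀ j → 1ℚ ≤ monomial C y j
monomial-≥1 inputs           y≥1 zero          = ≤-refl
monomial-≥1 inputs           y≥1 (suc i)       = y≥1 i
monomial-≥1 (C ▷ gate _ a b) y≥1 zero          = monomial-≥1 C y≥1 zero
monomial-≥1 (C ▷ gate _ a b) y≥1 (suc zero)    = 1≤p*q (monomial-≥1 C y≥1 a) (monomial-≥1 C y≥1 b)
monomial-≥1 (C ▷ gate _ a b) y≥1 (suc (suc j)) = monomial-≥1 C y≥1 (suc j)

output-inputs : ∀ y → output (inputs {n}) y ≡ 0ℚ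
output-inputs y = dot-zeroˡ (1ℚ ∷ᶠ y)

output-▷ : ∀ (C : Circuit n N) c a b y →
           output (C ▷ gate c a b) y ≡ c * (monomial C y a * monomial C y b) + output C y
output-▷ C c a b y = dot-insertAt₁ (coefficients C) (monomial C y) c _

output-▷-zero : ∀ (C : Circuit n N) a b y → output (C ▷ gate 0ℚ a b) y ≡ output C y
output-▷-zero C a b y = begin
  output (C ▷ gate 0ℚ a b) y                          ≡⟨ output-▷ C 0ℚ a b y ⟩
  0ℚ * (m a * m b) + output C y                       ≡⟨ cong (_+ output C y) (*-zeroˡ (m a * m b)) ⟩
  0ℚ + output C y                                     ≡⟨ +-identityˡ (output C y) ⟩
  output C y                                          ∎
  where
  open ≡-Reasoning
  m = monomial C y

satQuad-resp-≗ : ∀ {f g : Fin (suc N) → ℚ} → f ≗ g → ∀ e → satQuad g e → satQuad f e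
satQuad-resp-≗ f≗g (i , j , k , l) gi*gj≡gk*gl =
  trans (cong₂ _*_ (f≗g i) (f≗g j)) (trans gi*gj≡gk*gl (sym (cong₂ _*_ (f≗g k) (f≗g l))))

equations-hold : ∀ (C : Circuit n N) x y → All (satQuad (λ j → x * monomial C y j)) (equations C)
equations-hold inputs           x y = []
equations-hold (C ▷ gate _ a b) x y =
  new-equation ∷ map⁺ (All.map (λ {e} → satQuad-resp-≗ shift-monomial e) (equations-hold C x y))
  where
  m = monomial C y
  m′ = insertAt m (suc zero) (m a * m b)
  shift-monomial : ∀ j → x * m′ (shift j) ≡ x * m j
  shift-monomial j = cong (x *_) (insertAt-punchIn m (suc zero) _ j)
  new-equation : x * (m a * m b) * (x * m zero) ≡ x * m′ (shift a) * (x * m′ (shift b))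
  new-equation = begin
    x * (m a * m b) * (x * m zero) ≡⟨ cong (λ t → x * (m a * m b) * (x * t)) (monomial-zero C y) ⟩
    x * (m a * m b) * (x * 1ℚ)     ≡⟨ cong (x * (m a * m b) *_) (*-identityʳ x) ⟩
    x * (m a * m b) * x            ≡⟨ sym ([x*a]*[x*b]≡x*[a*b]*x x (m a) (m b)) ⟩
    x * m a * (x * m b)            ≡⟨ sym (cong₂ _*_ (shift-monomial a) (shift-monomial b)) ⟩
    x * m′ (shift a) * (x * m′ (shift b)) ∎
    where open ≡-Reasoning

equations-determine : ∀ (C : Circuit n N) (w : Fin (suc N) → ℚ) .{{_ : Positive (w zero)}} →
                      All (satQuad w) (equations C) →
                      ∀ j → w j ≡ w zero * monomial C (λ i → w (input C i) ÷' w zero) j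
equations-determine inputs w _ zero    = sym (*-identityʳ (w zero))
equations-determine inputs w _ (suc i) = sym (q*[p÷'q]≡p (w (suc i)) (w zero))
equations-determine (C ▷ gate _ a b) w (new-equation ∷ old-equations) = determine
  where
  w₀ = w zero
  m = monomial C (λ i → w (shift (input C i)) ÷' w₀)
  shifted : ∀ j → w (shift j) ≡ w₀ * m j
  shifted = equations-determine C (w ∘ shift) (map⁻ old-equations)
  determine : ∀ j → w j ≡ w₀ * insertAt m (suc zero) (m a * m b) j
  determine zero          = shifted zero
  determine (suc (suc j)) = shifted (suc j)
  determine (suc zero)    = *-cancelʳ-≡-pos w₀ (begin
    w (suc zero) * w₀        ≡⟨ new-equation ⟩
    w (shift a) * w (shift b) ≡⟨ cong₂ _*_ (shifted a) (shifted b) ⟩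
    w₀ * m a * (w₀ * m b)    ≡⟨ [x*a]*[x*b]≡x*[a*b]*x w₀ (m a) (m b) ⟩
    w₀ * (m a * m b) * w₀    ∎)
    where open ≡-Reasoning

record Extension (C : Circuit n N) (F : (Fin n → ℚ) → ℚ) : Set where
  field
    {size}         : ℕ
    circuit        : Circuit n size
    node           : Fin (suc size)
    monomial-node  : ∀ y → monomial circuit y node ≡ F y
    output-circuit : ∀ y → output circuit y ≡ output C y
open Extension

Extension-resp-≗ : ∀ {C : Circuit n N} {F G} → F ≗ G → Extension C F → Extension C G
Extension-resp-≗ F≗G E = record
  { circuit        = circuit E
  ; node           = node E
  ; monomial-node  = λ y → trans (monomial-node E y) (F≗G y)
  ; output-circuit = output-circuit E
  }

unitExtension : (C : Circuit n N) → Extension C (λ _ → 1ℚ)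
unitExtension C = record
  { circuit = C ; node = zero ; monomial-node = monomial-zero C ; output-circuit = λ _ → refl }

multiplyExtension : ∀ {C : Circuit n N} {F} → Extension C F → ∀ i → Extension C (λ y → y i * F y)
multiplyExtension E i = record
  { circuit        = circuit E ▷ gate 0ℚ (input (circuit E) i) (node E)
  ; node           = suc zero
  ; monomial-node  = λ y → cong₂ _*_ (monomial-input (circuit E) y i) (monomial-node E y)
  ; output-circuit = λ y → trans (output-▷-zero (circuit E) _ _ y) (output-circuit E y)
  }

powerExtension : ∀ {C : Circuit n N} {F} → Extension C F → ∀ i m →
                 Extension C (λ y → y i ^ℚ m * F y)
powerExtension {F = F} E i zero    = Extension-resp-≗ (λ y → sym (*-identityˡ (F y))) E
powerExtension {F = F} E i (suc m) = Extension-resp-≗ (λ y → sym (*-assoc (y i) (y i ^ℚ m) (F y)))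
                                       (multiplyExtension (powerExtension E i m) i)

productExtension : ∀ (C : Circuit n N) {k} (e : Vec ℕ k) (ix : Fin k → Fin n) →
                   Extension C (λ y → prodFin k (λ j → y (ix j) ^ℚ lookup e j))
productExtension C []       ix = unitExtension C
productExtension C (m ∷ e) ix = powerExtension (productExtension C e (ix ∘ suc)) (ix zero) m

-- The coefficient goes on a fresh copy t · q₀ = node · q₀ of the node, which for a
-- constant term is q₀ itself.
addTerm : Circuit n N → ℚ × Vec ℕ n → ∃ (Circuit n)
addTerm C (c , e) = _ , circuit E ▷ gate c (node E) zero
  where E = productExtension C e id

output-addTerm : ∀ (C : Circuit n N) t y → output (proj₂ (addTerm C t)) y ≡ evalMono y t + output C y
output-addTerm {n} C (c , e) y = begin
  output (circuit E ▷ gate c (node E) zero) y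
    ≡⟨ output-▷ (circuit E) c (node E) zero y ⟩
  c * (monomial (circuit E) y (node E) * monomial (circuit E) y zero) + output (circuit E) y
    ≡⟨ cong₂ (λ u v → c * (u * v) + output (circuit E) y)
             (monomial-node E y) (monomial-zero (circuit E) y) ⟩
  c * (Π * 1ℚ) + output (circuit E) y
    ≡⟨ cong₂ (λ u v → c * u + v) (*-identityʳ Π) (output-circuit E y) ⟩
  c * Π + output C y ∎
  where
  open ≡-Reasoning
  E = productExtension C e id
  Π = prodFin n (λ i → y i ^ℚ lookup e i)

compile : Poly n → ∃ (Circuit n)
compile []      = _ , inputs
compile (t ∷ P) = addTerm (proj₂ (compile P)) t

output-compile : ∀ (P : Poly n) y → output (proj₂ (compile P)) y ≡ eval P y
output-compile []      y = output-inputs y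
output-compile (t ∷ P) y =
  trans (output-addTerm (proj₂ (compile P)) t y) (cong (evalMono y t +_) (output-compile P y))

ScaledRoot : ((Fin n → ℚ) → ℚ) → Set
ScaledRoot {n} F = ∃ λ (q : Fin (suc n) → ℚ) →
    (q zero * F (λ i → q (suc i) ÷' q zero) ≡ 0ℚ)
  × ((i : Fin n) → q zero ≤ q (suc i))
  × ((i : Fin (suc n)) → 1ℚ ≤ q i)

ScaledRoot-resp-≗ : ∀ {F G : (Fin n → ℚ) → ℚ} → F ≗ G → ScaledRoot F → ScaledRoot G
ScaledRoot-resp-≗ F≗G (q , root , above , ≥1) =
  q , trans (cong (q zero *_) (sym (F≗G _))) root , above , ≥1

circuitInstance : Circuit n N → InstB
circuitInstance {N = N} C = mkB N (just (tabulate (coefficients C))) (equations C)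

sumFin-lookup-tabulate : ∀ (α w : Fin (suc N) → ℚ) →
                         sumFin (suc N) (λ j → lookup (tabulate α) j * w j) ≡ dot α w
sumFin-lookup-tabulate α w = sumFin-cong (λ j → cong (_* w j) (lookup∘tabulate α j))

scaledRoot⇒solution : ∀ (C : Circuit n N) → ScaledRoot (output C) → SolB (circuitInstance C)
scaledRoot⇒solution C (q , root , above , ≥1) =
  w , linear , equations-hold C q₀ y , ≤-trans (≥1 zero) (≤-reflexive (sym w₀≡q₀)) , w₀≤w ∘ suc
  where
  q₀ = q zero
  instance
    q₀-pos : Positive q₀
    q₀-pos = 1≤⇒pos (≥1 zero)
  y : Fin _ → ℚ
  y i = q (suc i) ÷' q₀
  w : Fin _ → ℚ
  w j = q₀ * monomial C y j
  w₀≡q₀ : w zero ≡ q₀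
  w₀≡q₀ = trans (cong (q₀ *_) (monomial-zero C y)) (*-identityʳ q₀)
  w₀≤w : ∀ j → w zero ≤ w j
  w₀≤w j = ≤-trans (≤-reflexive w₀≡q₀) (p≤p*q q₀ (monomial-≥1 C y≥1 j))
    where
    y≥1 : ∀ i → 1ℚ ≤ y i
    y≥1 i = 1≤p÷'q q₀ (above i)
  linear : sumFin _ (λ j → lookup (tabulate (coefficients C)) j * w j) ≡ 0ℚ
  linear = begin
    sumFin _ (λ j → lookup (tabulate (coefficients C)) j * w j)
      ≡⟨ sumFin-lookup-tabulate (coefficients C) w ⟩
    dot (coefficients C) w
      ≡⟨ dot-scaleʳ (coefficients C) q₀ (monomial C y) ⟩
    q₀ * output C y
      ≡⟨ root ⟩
    0ℚ ∎
    where open ≡-Reasoning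

solution⇒scaledRoot : ∀ (C : Circuit n N) → SolB (circuitInstance C) → ScaledRoot (output C)
solution⇒scaledRoot C (w , linear , solves , 1≤w₀ , above) =
  (w zero ∷ᶠ w ∘ input C) , root , w₀≤w ∘ input C , ≥1
  where
  w₀ = w zero
  instance
    w₀-pos : Positive w₀
    w₀-pos = 1≤⇒pos 1≤w₀
  y : Fin _ → ℚ
  y i = w (input C i) ÷' w₀
  w₀≤w : ∀ j → w₀ ≤ w j
  w₀≤w zero    = ≤-refl
  w₀≤w (suc j) = above j
  ≥1 : ∀ i → 1ℚ ≤ (w₀ ∷ᶠ w ∘ input C) i
  ≥1 zero    = 1≤w₀
  ≥1 (suc i) = ≤-trans 1≤w₀ (w₀≤w (input C i))
  determined : ∀ j → coefficients C j * w j ≡ coefficients C j * (w₀ * monomial C y j)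
  determined j = cong (coefficients C j *_) (equations-determine C w solves j)
  root : w₀ * output C y ≡ 0ℚ
  root = begin
    w₀ * output C y
      ≡⟨ dot-scaleʳ (coefficients C) w₀ (monomial C y) ⟨
    dot (coefficients C) (λ j → w₀ * monomial C y j)
      ≡⟨ sumFin-cong determined ⟨
    dot (coefficients C) w
      ≡⟨ sumFin-lookup-tabulate (coefficients C) w ⟨
    sumFin _ (λ j → lookup (tabulate (coefficients C)) j * w j)
      ≡⟨ linear ⟩
    0ℚ ∎
    where open ≡-Reasoning

lemma11 : Reduction InstA InstB SolA SolB
lemma11 = (λ (_ , P) → circuitInstance (proj₂ (compile P))) , λ (_ , P) → correct P
  where
  correct : ∀ {n} (P : Poly n) → SolA (n , P) ⇔ SolB (circuitInstance (proj₂ (compile P)))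
  correct P = mk⇔ (scaledRoot⇒solution C ∘ ScaledRoot-resp-≗ (sym ∘ output-compile P))
                  (ScaledRoot-resp-≗ (output-compile P) ∘ solution⇒scaledRoot C)
    where C = proj₂ (compile P)
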